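{- For every integer $k \geqslant 5$, $$g(3k+1,\, 3k+4,\, 6k+3,\, 6k+9) = (3k+1)\left(k - \left\lfloor \frac{3k+1}{21} \right\rfloor\right) - 1.$$
   Context: Let $a_1, \dots, a_n$ be positive integers with $\gcd(a_1,\dots,a_n)=1$. The Frobenius number $g(a_1,\dots,a_n)$ is the largest natural number that cannot be written as $c_1a_1+\dots+c_na_n$ with all $c_i$ non-negative integers. Here $\lfloor\cdot\rfloor$ denotes the floor function. -}

module Defs where

open import Data.Nat using (ℕ; _+_; _*_; _≤_)
open import Data.Vec using (Vec; []; _∷_)
open import Data.Product using (Σ; ∃; _×_)
open import Relation.Binary.PropositionalEquality using (_≡_)
open import Relation.Nullary using (¬_)

dot : ∀ {n} → Vec ℕ n → Vec ℕ n → ℕ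
dot [] [] = 0
dot (c ∷ cs) (a ∷ as) = c * a + dot cs as

Representable : ∀ {n} → Vec ℕ n → ℕ → Set
Representable {n} as m = Σ (Vec ℕ n) (λ cs → dot cs as ≡ m)

IsFrobeniusNumber : ∀ {n} → Vec ℕ n → ℕ → Set
IsFrobeniusNumber as g =
  ¬ Representable as g × (∀ m → ¬ Representable as m → m ≤ g)

module Submission where

-- The generators are 3k+1, 3k+4, 6k+3, 6k+9.  Writing A = 3k+1 they are
-- A, A+3, 2A+1, 2A+7, so a combination c·A + x(A+3) + y(2A+1) + z(2A+7)
-- equals (c + w)·A + s, where the triple (x, y, z) has weight w = x+2y+2z
-- and excess s = 3x+y+7z.  Excess costs weight at a rate of at least 2/7
-- (2s ≤ 7w), and conversely every excess r has a cheap realisation: weight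
-- at most 5, or 7w ≤ 2r+6.  With K = ⌈6k/7⌉, i.e. 6k ≤ 7K ≤ 6k+6, this gives
--   * K·A − 1 is not representable: a representation T·A + s with T < K
--     forces s ≥ 3k, hence 7K ≥ 7(T+1) ≥ 2s + 7 ≥ 6k + 7;
--   * every m ≥ K·A is representable: write m = Q·A + r with r ≤ 3k and
--     realise r cheaply; the weight is at most K ≤ Q.
-- So g(3k+1, 3k+4, 6k+3, 6k+9) = (3k+1)·⌈6k/7⌉ − 1 for k ≥ 5, and the
-- theorem follows from k − ⌊(3k+1)/21⌋ = ⌈6k/7⌉ (write k = 7q + e, e < 7).

open import Defs
open import Data.Vec using (Vec; []; _∷_)
open import Data.Nat
open import Data.Nat.Properties
open import Data.Nat.DivMod
open import Data.Nat.Divisibility using (divides)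
open import Data.Nat.Tactic.RingSolver using (solve-∀)
open import Data.Product using (Σ; _×_; _,_; proj₁; proj₂)
open import Data.Sum using (_⊎_; inj₁; inj₂)
open import Relation.Binary.PropositionalEquality
open import Relation.Nullary using (¬_; yes; no; contradiction)

gens : ℕ → Vec ℕ 4
gens k = 3 * k + 1 ∷ 3 * k + 4 ∷ 6 * k + 3 ∷ 6 * k + 9 ∷ []

-- Weight and excess of a triple (x, y, z) of multiplicities of 3k+4, 6k+3,
-- 6k+9.  The z-term comes first so that raising z by one adds 2 to the
-- weight and 7 to the excess definitionally.
weight : ℕ → ℕ → ℕ → ℕ
weight x y z = z * 2 + (x + y * 2)

excess : ℕ → ℕ → ℕ → ℕ
excess x y z = z * 7 + (x * 3 + y)

decompose : ∀ k c x y z →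
  dot (c ∷ x ∷ y ∷ z ∷ []) (gens k) ≡ (c + weight x y z) * (3 * k + 1) + excess x y z
decompose k c x y z = identity k c x y z
  where
  identity : ∀ k c x y z →
    c * (3 * k + 1) + (x * (3 * k + 4) + (y * (6 * k + 3) + (z * (6 * k + 9) + 0)))
      ≡ (c + (z * 2 + (x + y * 2))) * (3 * k + 1) + (z * 7 + (x * 3 + y))
  identity = solve-∀

excess-bound : ∀ x y z → excess x y z * 2 ≤ weight x y z * 7
excess-bound x y z = subst (excess x y z * 2 ≤_) (sym (identity x y z)) (m≤m+n _ _)
  where
  identity : ∀ x y z → (z * 2 + (x + y * 2)) * 7 ≡ (z * 7 + (x * 3 + y)) * 2 + (x + y * 12)
  identity = solve-∀

record Realisation (r : ℕ) : Set where
  constructor realisation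
  field
    x y z    : ℕ
    realises : excess x y z ≡ r

cost : ∀ {r} → Realisation r → ℕ
cost (realisation x y z _) = weight x y z

-- From 12 on, every excess r is realised with 7·weight ≤ 2r + 6: the cases
-- 12, …, 18 are checked directly, and one more 6k+9 adds 7 to the excess
-- and 2 to the weight, which preserves the bound.
dense-realisation : ∀ n → Σ (Realisation (12 + n)) λ t → cost t * 7 ≤ (12 + n) * 2 + 6
dense-realisation 0 = realisation 4 0 0 refl , ≤ᵇ⇒≤ _ _ _
dense-realisation 1 = realisation 2 0 1 refl , ≤ᵇ⇒≤ _ _ _
dense-realisation 2 = realisation 0 0 2 refl , ≤ᵇ⇒≤ _ _ _
dense-realisation 3 = realisation 5 0 0 refl , ≤ᵇ⇒≤ _ _ _
dense-realisation 4 = realisation 3 0 1 refl , ≤ᵇ⇒≤ _ _ _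
dense-realisation 5 = realisation 1 0 2 refl , ≤ᵇ⇒≤ _ _ _
dense-realisation 6 = realisation 6 0 0 refl , ≤ᵇ⇒≤ _ _ _
dense-realisation (suc (suc (suc (suc (suc (suc (suc n))))))) with dense-realisation n
... | realisation x y z realises , bound =
  realisation x y (suc z) (cong (7 +_) realises) , +-monoʳ-≤ 14 bound

Cheap : ∀ {r} → Realisation r → Set
Cheap {r} t = cost t ≤ 5 ⊎ cost t * 7 ≤ r * 2 + 6

cheap-realisation : ∀ r → Σ (Realisation r) Cheap
cheap-realisation 0 = realisation 0 0 0 refl , inj₁ (≤ᵇ⇒≤ _ _ _)
cheap-realisation 1 = realisation 0 1 0 refl , inj₁ (≤ᵇ⇒≤ _ _ _)
cheap-realisation 2 = realisation 0 2 0 refl , inj₁ (≤ᵇ⇒≤ _ _ _)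
cheap-realisation 3 = realisation 1 0 0 refl , inj₁ (≤ᵇ⇒≤ _ _ _)
cheap-realisation 4 = realisation 1 1 0 refl , inj₁ (≤ᵇ⇒≤ _ _ _)
cheap-realisation 5 = realisation 1 2 0 refl , inj₁ (≤ᵇ⇒≤ _ _ _)
cheap-realisation 6 = realisation 2 0 0 refl , inj₁ (≤ᵇ⇒≤ _ _ _)
cheap-realisation 7 = realisation 0 0 1 refl , inj₁ (≤ᵇ⇒≤ _ _ _)
cheap-realisation 8 = realisation 0 1 1 refl , inj₁ (≤ᵇ⇒≤ _ _ _)
cheap-realisation 9 = realisation 3 0 0 refl , inj₁ (≤ᵇ⇒≤ _ _ _)
cheap-realisation 10 = realisation 1 0 1 refl , inj₁ (≤ᵇ⇒≤ _ _ _)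
cheap-realisation 11 = realisation 1 1 1 refl , inj₁ (≤ᵇ⇒≤ _ _ _)
cheap-realisation (suc (suc (suc (suc (suc (suc (suc (suc (suc (suc (suc (suc n)))))))))))) =
  let (t , bound) = dense-realisation n in t , inj₂ bound

twice-three-k : ∀ k → 3 * k * 2 ≡ 6 * k
twice-three-k = solve-∀

first-generator-nonZero : ∀ k → NonZero (3 * k + 1)
first-generator-nonZero k = >-nonZero (m≤n+m 1 (3 * k))

just-below-multiple : ∀ A T K s → T * A + suc s ≡ K * A → T < K × A ≤ suc s
just-below-multiple A T K s eq = T<K , +-cancelʳ-≤ (T * A) A (suc s) A+TA≤1+s+TA
  where
  open ≤-Reasoning
  T<K : T < K
  T<K = *-cancelʳ-< A T K (subst (T * A <_) eq (m<m+n (T * A) z<s))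
  A+TA≤1+s+TA : A + T * A ≤ suc s + T * A
  A+TA≤1+s+TA = begin
    suc T * A     ≤⟨ *-monoˡ-≤ A T<K ⟩
    K * A         ≡⟨ eq ⟨
    T * A + suc s ≡⟨ +-comm (T * A) (suc s) ⟩
    suc s + T * A ∎

-- The gap: when 7K ≤ 6k + 6, the number K·(3k+1) − 1 is not T·(3k+1) + s
-- with 2s ≤ 7T.  Such an s would be at least 3k, forcing 7K ≥ 6k + 7.
gap : ∀ k K T s → 7 * K ≤ 6 * k + 6 → s * 2 ≤ T * 7 →
      T * (3 * k + 1) + suc s ≢ K * (3 * k + 1)
gap k K T s upper s-bound eq = <⇒≱ overshoot upper
  where
  open ≤-Reasoning
  below : T < K × 3 * k + 1 ≤ suc s
  below = just-below-multiple (3 * k + 1) T K s eq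
  T<K : T < K
  T<K = proj₁ below
  3k≤s : 3 * k ≤ s
  3k≤s = +-cancelʳ-≤ 1 (3 * k) s (subst (3 * k + 1 ≤_) (+-comm 1 s) (proj₂ below))
  overshoot : 6 * k + 6 < 7 * K
  overshoot = begin-strict
    6 * k + 6     ≡⟨ cong (_+ 6) (twice-three-k k) ⟨
    3 * k * 2 + 6 ≤⟨ +-monoˡ-≤ 6 (*-monoˡ-≤ 2 3k≤s) ⟩
    s * 2 + 6     <⟨ +-monoʳ-< (s * 2) (n<1+n 6) ⟩
    s * 2 + 7     ≤⟨ +-monoˡ-≤ 7 s-bound ⟩
    T * 7 + 7     ≡⟨ +-comm (T * 7) 7 ⟩
    suc T * 7     ≤⟨ *-monoˡ-≤ 7 T<K ⟩
    K * 7         ≡⟨ *-comm K 7 ⟩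
    7 * K         ∎

cancel-seven : ∀ w K → w * 7 ≤ K * 7 + 6 → w ≤ K
cancel-seven w K bound =
  m<1+n⇒m≤n (*-cancelʳ-< 7 w (suc K) (s≤s (subst (w * 7 ≤_) (+-comm (K * 7) 6) bound)))

cheap-fits : ∀ k K {r} (t : Realisation r) → 5 ≤ K → 6 * k ≤ 7 * K → r ≤ 3 * k → Cheap t →
             cost t ≤ K
cheap-fits k K t K≥5 lower r≤3k (inj₁ w≤5) = ≤-trans w≤5 K≥5
cheap-fits k K {r} t K≥5 lower r≤3k (inj₂ w-bound) = cancel-seven (cost t) K (begin
  cost t * 7    ≤⟨ w-bound ⟩
  r * 2 + 6     ≤⟨ +-monoˡ-≤ 6 (*-monoˡ-≤ 2 r≤3k) ⟩
  3 * k * 2 + 6 ≡⟨ cong (_+ 6) (twice-three-k k) ⟩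
  6 * k + 6     ≤⟨ +-monoˡ-≤ 6 lower ⟩
  7 * K + 6     ≡⟨ cong (_+ 6) (*-comm 7 K) ⟩
  K * 7 + 6     ∎)
  where open ≤-Reasoning

extend : ∀ k Q {r} (t : Realisation r) → cost t ≤ Q → Representable (gens k) (Q * (3 * k + 1) + r)
extend k Q {r} (realisation x y z realises) w≤Q = (Q ∸ weight x y z ∷ x ∷ y ∷ z ∷ []) , (begin
  dot (Q ∸ weight x y z ∷ x ∷ y ∷ z ∷ []) (gens k)
    ≡⟨ decompose k (Q ∸ weight x y z) x y z ⟩
  (Q ∸ weight x y z + weight x y z) * (3 * k + 1) + excess x y z
    ≡⟨ cong₂ (λ c s → c * (3 * k + 1) + s) (m∸n+n≡m w≤Q) realises ⟩
  Q * (3 * k + 1) + r ∎)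
  where open ≡-Reasoning

-- When 6k ≤ 7K and K ≥ 5, every m ≥ K·(3k+1) is representable: the
-- remainder of m modulo 3k+1 is at most 3k and has a cheap realisation,
-- whose weight is at most K, which in turn is at most the quotient.
representable-above : ∀ k K → 5 ≤ K → 6 * k ≤ 7 * K →
                      ∀ m → K * (3 * k + 1) ≤ m → Representable (gens k) m
representable-above k K K≥5 lower m Km =
  subst (Representable (gens k)) m≡QA+r (extend k Q t (≤-trans w≤K K≤Q))
  where
  A : ℕ
  A = 3 * k + 1
  instance A-nonZero : NonZero A
           A-nonZero = first-generator-nonZero k
  Q r : ℕ
  Q = m / A
  r = m % A
  t : Realisation r
  t = proj₁ (cheap-realisation r)
  m≡QA+r : Q * A + r ≡ m
  m≡QA+r = trans (+-comm (Q * A) r) (sym (m≡m%n+[m/n]*n m A))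
  K≤Q : K ≤ Q
  K≤Q = subst (_≤ Q) (m*n/n≡m K A) (/-monoˡ-≤ A Km)
  r≤3k : r ≤ 3 * k
  r≤3k = +-cancelʳ-≤ 1 r (3 * k) (subst (_≤ A) (+-comm 1 r) (m%n<n m A))
  w≤K : cost t ≤ K
  w≤K = cheap-fits k K t K≥5 lower r≤3k (proj₂ (cheap-realisation r))

IsCeilSixSevenths : ℕ → ℕ → Set
IsCeilSixSevenths k K = 6 * k ≤ 7 * K × 7 * K ≤ 6 * k + 6

frobenius-ceiling : ∀ k K → 5 ≤ k → IsCeilSixSevenths k K →
                    IsFrobeniusNumber (gens k) ((3 * k + 1) * K ∸ 1)
frobenius-ceiling k K k≥5 (lower , upper) = not-representable , maximal
  where
  open ≡-Reasoning
  A : ℕ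
  A = 3 * k + 1
  instance A-nonZero : NonZero A
           A-nonZero = first-generator-nonZero k
  G : ℕ
  G = A * K ∸ 1
  -- 7K ≥ 6k ≥ 30 > 7·4, so the light realisations (weight ≤ 5) fit.
  K≥5 : 5 ≤ K
  K≥5 = *-cancelˡ-< 7 4 K (<-≤-trans (≤ᵇ⇒≤ 29 30 _) (≤-trans (*-monoʳ-≤ 6 k≥5) lower))
  1+G : suc G ≡ K * A
  1+G = begin
    suc G ≡⟨ +-comm 1 G ⟩
    G + 1 ≡⟨ m∸n+n≡m (≤-trans (≤-trans (s≤s z≤n) K≥5) (m≤n*m K A)) ⟩
    A * K ≡⟨ *-comm A K ⟩
    K * A ∎
  not-representable : ¬ Representable (gens k) G
  not-representable ((c ∷ x ∷ y ∷ z ∷ []) , eq) =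
    gap k K (c + weight x y z) (excess x y z) upper
      (≤-trans (excess-bound x y z) (*-monoˡ-≤ 7 (m≤n+m (weight x y z) c)))
      (begin
        (c + weight x y z) * A + suc (excess x y z)   ≡⟨ +-suc _ _ ⟩
        suc ((c + weight x y z) * A + excess x y z)   ≡⟨ cong suc (decompose k c x y z) ⟨
        suc (dot (c ∷ x ∷ y ∷ z ∷ []) (gens k))       ≡⟨ cong suc eq ⟩
        suc G                                          ≡⟨ 1+G ⟩
        K * A                                          ∎)
  maximal : ∀ m → ¬ Representable (gens k) m → m ≤ G
  maximal m not-rep with m ≤? G
  ... | yes m≤G = m≤G
  ... | no m≰G =
    contradiction (representable-above k K K≥5 lower m (subst (_≤ m) 1+G (≰⇒> m≰G))) not-rep

multiplier : ℕ → ℕ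
multiplier k = k ∸ (3 * k + 1) / 21

-- For k = e + 7q with e < 7 we have 3k+1 = (3e+1) + 21q with 3e+1 < 21,
-- so ⌊(3k+1)/21⌋ = q and the multiplier is e + 6q.
multiplier-of-7q+e : ∀ q e → e < 7 → multiplier (e + q * 7) ≡ e + q * 6
multiplier-of-7q+e q e e<7 = begin
  e + q * 7 ∸ (3 * (e + q * 7) + 1) / 21
    ≡⟨ cong (λ n → e + q * 7 ∸ n / 21) (numerator q e) ⟩
  e + q * 7 ∸ (3 * e + 1 + q * 21) / 21
    ≡⟨ cong (e + q * 7 ∸_) (+-distrib-/-∣ʳ (3 * e + 1) (divides q refl)) ⟩
  e + q * 7 ∸ ((3 * e + 1) / 21 + q * 21 / 21)
    ≡⟨ cong₂ (λ a b → e + q * 7 ∸ (a + b)) (m<n⇒m/n≡0 3e+1<21) (m*n/n≡m q 21) ⟩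
  e + q * 7 ∸ q
    ≡⟨ cong (_∸ q) (split q e) ⟩
  e + q * 6 + q ∸ q
    ≡⟨ m+n∸n≡m (e + q * 6) q ⟩
  e + q * 6 ∎
  where
  open ≡-Reasoning
  numerator : ∀ q e → 3 * (e + q * 7) + 1 ≡ 3 * e + 1 + q * 21
  numerator = solve-∀
  split : ∀ q e → e + q * 7 ≡ e + q * 6 + q
  split = solve-∀
  3e+1<21 : 3 * e + 1 < 21
  3e+1<21 = ≤-trans (s≤s (+-monoˡ-≤ 1 (*-monoʳ-≤ 3 (m<1+n⇒m≤n e<7)))) (n≤1+n 20)

-- Hence the multiplier is ⌈6k/7⌉: 7(e + 6q) = 6(e + 7q) + e with e ≤ 6.
multiplier-is-ceiling : ∀ k → IsCeilSixSevenths k (multiplier k)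
multiplier-is-ceiling k =
  subst (λ n → IsCeilSixSevenths n (multiplier n)) (sym (m≡m%n+[m/n]*n k 7))
        (ceiling (k / 7) (k % 7) (m%n<n k 7))
  where
  sevenfold : ∀ q e → 7 * (e + q * 6) ≡ 6 * (e + q * 7) + e
  sevenfold = solve-∀
  ceiling : ∀ q e → e < 7 → IsCeilSixSevenths (e + q * 7) (multiplier (e + q * 7))
  ceiling q e e<7 =
    subst (IsCeilSixSevenths (e + q * 7)) (sym (multiplier-of-7q+e q e e<7))
      ( subst (6 * (e + q * 7) ≤_) (sym (sevenfold q e)) (m≤m+n _ e)
      , subst (_≤ 6 * (e + q * 7) + 6) (sym (sevenfold q e))
              (+-monoʳ-≤ (6 * (e + q * 7)) (m<1+n⇒m≤n e<7)))

mainTheorem1 : (k : ℕ) → 5 ≤ k →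
    IsFrobeniusNumber (3 * k + 1 ∷ 3 * k + 4 ∷ 6 * k + 3 ∷ 6 * k + 9 ∷ [])
      ((3 * k + 1) * (k ∸ ((3 * k + 1) / 21)) ∸ 1)
mainTheorem1 k k≥5 = frobenius-ceiling k (multiplier k) k≥5 (multiplier-is-ceiling k)
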